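{- For every $X\in ES$, the class of single-coalition-first action $X$-models is $z$-representable by the class of single-coalition-first neighborhood $X$-models; that is, every single-coalition-first action $X$-model is $z$-representable by some single-coalition-first neighborhood $X$-model, and every single-coalition-first neighborhood $X$-model $z$-represents some single-coalition-first action $X$-model.
   Context: $AG$ is a finite nonempty set of agents, $AP$ a countable set of atomic propositions. For a nonempty set $AC$ and $C\subseteq AG$, $JA_C$ is the set of functions $\sigma_C:C\to AC$ ($JA_\emptyset=\{\emptyset\}$); $\sigma_C|_{\{a\}}$ is the restriction to $\{a\}$; for disjoint $C,D$, $\sigma_C\cup\sigma_D\in JA_{C\cup D}$. A single-coalition-first action model is $M=(ST,AC,suc,\{out_a\}_{a\in AG},L)$ with $ST,AC$ nonempty, $suc:ST\to\mathcal P(ST)$, $out_a:ST\times JA_{\{a\}}\to\mathcal P(ST)$ with $\bigcup\{out_a(s,\sigma_a)\mid\sigma_a\in JA_{\{a\}}\}=suc(s)$ for all $s$, $L:ST\to\mathcal P(AP)$. It determines $out_\emptyset(s,\emptyset)=suc(s)$, $out_C(s,\sigma_C)=\bigcap\{out_a(s,\sigma_C|_{\{a\}})\mid a\in C\}$ for nonempty $C$, $av_C(s)=\{\sigma_C\mid out_C(s,\sigma_C)\neq\emptyset\}$, $AE_C(s)=\{out_C(s,\sigma_C)\mid\sigma_C\in av_C(s)\}$. $M$ is serial if $av_C(s)\neq\emptyset$ for all $C,s$; independent if for all $s$, disjoint $C,D$, $\sigma_C\in av_C(s)$, $\sigma_D\in av_D(s)$: $\sigma_C\cup\sigma_D\in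 av_{C\cup D}(s)$; deterministic if $out_{AG}(s,\sigma_{AG})$ is a singleton for all $s$ and $\sigma_{AG}\in av_{AG}(s)$. A single-coalition-first neighborhood model is $N=(ST,suc,\{nei_a\}_{a\in AG},L)$ with $ST$ nonempty, $suc:ST\to\mathcal P(ST)$, $L:ST\to\mathcal P(AP)$, $nei_a(s)\subseteq\mathcal P(ST)$ a cover of $suc(s)$ (union $suc(s)$, $\emptyset\notin nei_a(s)$). With $\Delta_1\odot\Delta_2=\{Y_1\cap Y_2\mid Y_i\in\Delta_i,Y_1\cap Y_2\neq\emptyset\}$ (extended to finitely many families, $\bigodot\{\Delta\}=\Delta$): $nei_C(s)=\emptyset$ if $suc(s)=\emptyset$; $\{suc(s)\}$ if $suc(s)\neq\emptyset$, $C=\emptyset$; $\bigodot\{nei_a(s)\mid a\in C\}$ otherwise. $N$ is serial if $nei_C(s)\neq\emptyset$ for all $C,s$; independent if for all $s$, disjoint $C,D$, $Y_1\in nei_C(s)$, $Y_2\in nei_D(s)$: $Y_1\cap Y_2\neq\emptyset$; deterministic if every $Y\in nei_{AG}(s)$ is a singleton. $ES=\{\epsilon,\mathtt S,\mathtt I,\mathtt D,\mathtt{SI},\mathtt{SD},\mathtt{ID},\mathtt{SID}\}$; an $X$-model has the properties whose letters ($\mathtt S$, $\mathtt I$, $\mathtt D$) occur in $X$. $M$ is $z$-representable by $N$ ($N$ $z$-represents $M$) if they share $ST$ and $L$ and $AE_C=nei_C$ for all $C\subseteq AG$. -}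

module Defs where

open import Level using (0ℓ)
open import Data.Bool using (Bool; true; false; if_then_else_)
open import Data.Nat using (ℕ)
open import Data.Fin using (Fin)
open import Data.Fin.Subset using (Subset; _∈_; _∪_; ⊤; Nonempty)
open import Data.Fin.Subset.Properties using (x∈p∪q⁻; nonempty?)
open import Data.Product using (Σ; ∃; _×_; _,_)
open import Data.Sum using ([_,_])
open import Data.Unit using () renaming (⊤ to Unit)
open import Data.Empty using (⊥)
open import Relation.Nullary using (Dec; yes; no)
open import Relation.Unary using (Pred; _≐_; Satisfiable; _∩_)
open import Relation.Binary.PropositionalEquality using (_≡_)

AP : Set
AP = ℕ

Sub : Set → Set₁
Sub ST = Pred ST 0ℓ

-- A set of subsets of ST, presented as an indexed family
-- (the members are  mem i  for  i : Idx).
record Family (ST : Set) : Set₁ where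
  constructor fam
  field
    Idx : Set
    mem : Idx → Sub ST
open Family public

_≋_ : {ST : Set} → Family ST → Family ST → Set
F ≋ G = ((i : Idx F) → Σ (Idx G) λ j → mem F i ≐ mem G j)
      × ((j : Idx G) → Σ (Idx F) λ i → mem F i ≐ mem G j)

IsSingleton : {ST : Set} → Sub ST → Set
IsSingleton {ST} Y = Σ ST λ y → ∀ z → (Y z → z ≡ y) × (z ≡ y → Y z)

Disjoint : {n : ℕ} → Subset n → Subset n → Set
Disjoint {n} C D = (a : Fin n) → a ∈ C → a ∈ D → ⊥

data ES : Set where
  ε 𝕊 𝕀 𝔻 𝕊𝕀 𝕊𝔻 𝕀𝔻 𝕊𝕀𝔻 : ES

hasS hasI hasD : ES → Bool
hasS 𝕊 = true
hasS 𝕊𝕀 = true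
hasS 𝕊𝔻 = true
hasS 𝕊𝕀𝔻 = true
hasS _ = false
hasI 𝕀 = true
hasI 𝕊𝕀 = true
hasI 𝕀𝔻 = true
hasI 𝕊𝕀𝔻 = true
hasI _ = false
hasD 𝔻 = true
hasD 𝕊𝔻 = true
hasD 𝕀𝔻 = true
hasD 𝕊𝕀𝔻 = true
hasD _ = false

Req : Bool → Set → Set
Req b P = if b then P else Unit

-- Agents: AG = Fin (suc n) (finite, nonempty); the parameter k below
-- is the number of agents.

module _ (k : ℕ) where

  JA : (AC : Set) → Subset k → Set
  JA AC C = (a : Fin k) → a ∈ C → AC

  -- σ_C ∪ σ_D  (meaningful for disjoint C, D)
  joinJA : {AC : Set} (C D : Subset k) → JA AC C → JA AC D → JA AC (C ∪ D)
  joinJA C D σC σD a h = [ σC a , σD a ] (x∈p∪q⁻ C D h)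

  -- Single-coalition-first action models.  out_a takes σ_a ∈ JA_{a},
  -- identified with an action in AC.
  record ActionModel (ST : Set) (L : ST → Pred AP 0ℓ) : Set₁ where
    field
      AC    : Set
      acNE  : AC
      sc    : ST → Sub ST
      out   : Fin k → ST → AC → Sub ST
      cover : ∀ a s → sc s ≐ (λ y → Σ AC λ α → out a s α y)

    outC' : ∀ s C → Dec (Nonempty C) → JA AC C → Sub ST
    outC' s C (no _)  σ y = sc s y
    outC' s C (yes _) σ y = (a : Fin k) (p : a ∈ C) → out a s (σ a p) y

    outC : ∀ s C → JA AC C → Sub ST
    outC s C σ = outC' s C (nonempty? C) σ

    av : ∀ s C → JA AC C → Set
    av s C σ = Satisfiable (outC s C σ)

    AE : ∀ C → ST → Family ST
    AE C s = fam (Σ (JA AC C) λ σ → av s C σ) (λ p → outC s C (Data.Product.proj₁ p))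

    Serial : Set
    Serial = ∀ C s → Σ (JA AC C) λ σ → av s C σ

    Independent : Set
    Independent = ∀ s C D → Disjoint C D → (σC : JA AC C) (σD : JA AC D) →
                  av s C σC → av s D σD → av s (C ∪ D) (joinJA C D σC σD)

    Deterministic : Set
    Deterministic = ∀ s (σ : JA AC ⊤) → av s ⊤ σ → IsSingleton (outC s ⊤ σ)

  -- Single-coalition-first neighborhood models.  nei_a(s) is the family
  -- indexed by  NI a s.
  record NbhdModel (ST : Set) (L : ST → Pred AP 0ℓ) : Set₁ where
    field
      sc      : ST → Sub ST
      NI      : Fin k → ST → Set
      nb      : ∀ a s → NI a s → Sub ST
      nbNE    : ∀ a s (i : NI a s) → Satisfiable (nb a s i)
      cover   : ∀ a s → sc s ≐ (λ y → Σ (NI a s) λ i → nb a s i y)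

    -- ⊙{ nei_a(s) | a ∈ C } : choose one member per agent, keep nonempty intersections
    odotI : ST → Subset k → Set
    odotI s C = Σ ((a : Fin k) → a ∈ C → NI a s) λ f →
                  Satisfiable (λ y → (a : Fin k) (p : a ∈ C) → nb a s (f a p) y)

    odotM : ∀ s C → odotI s C → Sub ST
    odotM s C (f , _) y = (a : Fin k) (p : a ∈ C) → nb a s (f a p) y

    -- nei_C(s): empty if suc(s) = ∅; {suc(s)} if C = ∅; ⊙ otherwise.
    neiI' : ∀ s C → Dec (Nonempty C) → Set
    neiI' s C (no _)  = Unit
    neiI' s C (yes _) = odotI s C

    neiM' : ∀ s C (d : Dec (Nonempty C)) → neiI' s C d → Sub ST
    neiM' s C (no _)  _ = sc s
    neiM' s C (yes _) i = odotM s C i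

    nei : Subset k → ST → Family ST
    nei C s = fam (Satisfiable (sc s) × neiI' s C (nonempty? C))
                  (λ p → neiM' s C (nonempty? C) (Data.Product.proj₂ p))

    Serial : Set
    Serial = ∀ C s → Idx (nei C s)

    Independent : Set
    Independent = ∀ s C D → Disjoint C D → (i : Idx (nei C s)) (j : Idx (nei D s)) →
                  Satisfiable (mem (nei C s) i ∩ mem (nei D s) j)

    Deterministic : Set
    Deterministic = ∀ s (i : Idx (nei ⊤ s)) → IsSingleton (mem (nei ⊤ s) i)

  IsXAction : ∀ {ST L} → ES → ActionModel ST L → Set
  IsXAction X M = Req (hasS X) Serial × Req (hasI X) Independent × Req (hasD X) Deterministic
    where open ActionModel M

  IsXNbhd : ∀ {ST L} → ES → NbhdModel ST L → Set
  IsXNbhd X N = Req (hasS X) Serial × Req (hasI X) Independent × Req (hasD X) Deterministic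
    where open NbhdModel N

  -- N z-represents M: same ST and L (shared parameters), AE_C = nei_C for all C.
  ZRepresents : ∀ {ST L} → NbhdModel ST L → ActionModel ST L → Set
  ZRepresents {ST} N M = ∀ (C : Subset k) (s : ST) → ActionModel.AE M C s ≋ NbhdModel.nei N C s

{-# OPTIONS --safe #-}
module Submission where

-- Both kinds of model present, at every state and for every coalition C, a
-- family of outcome sets (AE_C, resp. nei_C), and seriality, independence and
-- determinism are properties of that family alone; for action models this
-- rests on out_{C∪D}(σ_C ∪ σ_D) = out_C(σ_C) ∩ out_D(σ_D) for disjoint C, D.
-- Hence the three properties transfer along a z-representation, and it only
-- remains to build representations.  Since AE_C and nei_C are both generated
-- from the single agents by intersecting one choice per agent, it suffices to
-- match the families of one agent: a neighbourhood model takes the nonempty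
-- outcome sets of an agent as its neighbourhoods, and an action model takes
-- the neighbourhoods themselves, tagged with agent and state, as actions.

open import Defs
open import Level using (0ℓ)
open import Data.Nat using (ℕ; suc)
open import Data.Fin using (Fin)
open import Data.Fin.Subset using (Subset; _∈_; _∪_; ⊤; Nonempty)
open import Data.Fin.Subset.Properties using (x∈p∪q⁻; x∈p∪q⁺; nonempty?)
open import Data.Vec.Properties.WithK using ([]=-irrelevant)
open import Data.Bool using (true; false)
open import Data.Maybe using (Maybe; just; nothing)
open import Data.Product using (Σ; _×_; _,_; proj₁; proj₂; map₂)
open import Data.Sum using (inj₁; inj₂)
open import Data.Unit using (tt)
open import Data.Empty using (⊥-elim)
open import Relation.Nullary using (Dec; yes; no)
open import Relation.Unary using (Pred; _≐_; _∩_; Satisfiable; ∅)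
open import Relation.Unary.Properties using (≐-refl; ≐-sym)
open import Relation.Binary.PropositionalEquality using (_≡_; refl)

Req-map : ∀ b {P Q : Set} → (P → Q) → Req b P → Req b Q
Req-map true  f p = f p
Req-map false f _ = tt

module _ {ST : Set} where

  IsSingleton-resp-≐ : {A B : Sub ST} → A ≐ B → IsSingleton A → IsSingleton B
  IsSingleton-resp-≐ (A⊆B , B⊆A) (y , A≡y) =
    y , λ z → (λ z∈B → proj₁ (A≡y z) (B⊆A z∈B)) , (λ z≡y → A⊆B (proj₂ (A≡y z) z≡y))

  ≋-refl : {F : Family ST} → F ≋ F
  ≋-refl = (λ i → i , ≐-refl) , (λ i → i , ≐-refl)

  ≋-sym : {F G : Family ST} → F ≋ G → G ≋ F
  ≋-sym (F⇒G , G⇒F) = (λ j → map₂ ≐-sym (G⇒F j)) , (λ i → map₂ ≐-sym (F⇒G i))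

module _ {k : ℕ} {ST : Set} where

  ⋂[_] : (C : Subset k) → ((a : Fin k) → a ∈ C → Sub ST) → Sub ST
  ⋂[ C ] P y = (a : Fin k) (p : a ∈ C) → P a p y

  ⋂-cong : ∀ {C} {P Q : (a : Fin k) → a ∈ C → Sub ST} →
           (∀ a p → P a p ≐ Q a p) → ⋂[ C ] P ≐ ⋂[ C ] Q
  ⋂-cong P≐Q = (λ h a p → proj₁ (P≐Q a p) (h a p)) , (λ h a p → proj₂ (P≐Q a p) (h a p))

  ⋂-joinJA : ∀ {A : Set} {C D} (Q : Fin k → A → Sub ST) {σC : JA k A C} {σD : JA k A D} →
             Disjoint C D →
             ⋂[ C ∪ D ] (λ a p → Q a (joinJA k C D σC σD a p))
               ≐ ⋂[ C ] (λ a p → Q a (σC a p)) ∩ ⋂[ D ] (λ a p → Q a (σD a p))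
  ⋂-joinJA {C = C} {D} Q {σC} {σD} C∩D≡∅ = split , merge
    where
    merge : ∀ {y} → (⋂[ C ] (λ a p → Q a (σC a p)) ∩ ⋂[ D ] (λ a p → Q a (σD a p))) y →
            ⋂[ C ∪ D ] (λ a p → Q a (joinJA k C D σC σD a p)) y
    merge (hC , hD) a p with x∈p∪q⁻ C D p
    ... | inj₁ a∈C = hC a a∈C
    ... | inj₂ a∈D = hD a a∈D

    left : ∀ {y} a (a∈C : a ∈ C) → ⋂[ C ∪ D ] (λ a p → Q a (joinJA k C D σC σD a p)) y →
           Q a (σC a a∈C) y
    left a a∈C h with x∈p∪q⁻ C D (x∈p∪q⁺ (inj₁ a∈C)) | h a (x∈p∪q⁺ (inj₁ a∈C))
    ... | inj₁ a∈C′ | q rewrite []=-irrelevant a∈C′ a∈C = q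
    ... | inj₂ a∈D  | _ = ⊥-elim (C∩D≡∅ a a∈C a∈D)

    right : ∀ {y} a (a∈D : a ∈ D) → ⋂[ C ∪ D ] (λ a p → Q a (joinJA k C D σC σD a p)) y →
            Q a (σD a a∈D) y
    right a a∈D h with x∈p∪q⁻ C D (x∈p∪q⁺ (inj₂ a∈D)) | h a (x∈p∪q⁺ (inj₂ a∈D))
    ... | inj₂ a∈D′ | q rewrite []=-irrelevant a∈D′ a∈D = q
    ... | inj₁ a∈C  | _ = ⊥-elim (C∩D≡∅ a a∈C a∈D)

    split : ∀ {y} → ⋂[ C ∪ D ] (λ a p → Q a (joinJA k C D σC σD a p)) y →
            (⋂[ C ] (λ a p → Q a (σC a p)) ∩ ⋂[ D ] (λ a p → Q a (σD a p))) y
    split h = (λ a p → left a p h) , (λ a p → right a p h)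

  CoalitionFamily : Set₁
  CoalitionFamily = Subset k → ST → Family ST

  SerialFam : CoalitionFamily → Set
  SerialFam F = ∀ C s → Idx (F C s)

  IndependentFam : CoalitionFamily → Set
  IndependentFam F = ∀ s C D → Disjoint C D → (i : Idx (F C s)) (j : Idx (F D s)) →
                     Satisfiable (mem (F C s) i ∩ mem (F D s) j)

  DeterministicFam : CoalitionFamily → Set
  DeterministicFam F = ∀ s (i : Idx (F ⊤ s)) → IsSingleton (mem (F ⊤ s) i)

  IsXFam : ES → CoalitionFamily → Set
  IsXFam X F = Req (hasS X) (SerialFam F) × Req (hasI X) (IndependentFam F)
             × Req (hasD X) (DeterministicFam F)

  IsXFam-resp-≋ : ∀ X {F G : CoalitionFamily} → (∀ C s → F C s ≋ G C s) →
                  IsXFam X F → IsXFam X G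
  IsXFam-resp-≋ X {F} {G} F≋G (ser , ind , det) =
    Req-map (hasS X) serial ser , Req-map (hasI X) independent ind ,
    Req-map (hasD X) deterministic det
    where
    serial : SerialFam F → SerialFam G
    serial ser C s = proj₁ (proj₁ (F≋G C s) (ser C s))

    independent : IndependentFam F → IndependentFam G
    independent ind s C D C∩D≡∅ i j =
      let (i′ , Fi′≐Gi) = proj₂ (F≋G C s) i
          (j′ , Fj′≐Gj) = proj₂ (F≋G D s) j
      in map₂ (λ (yC , yD) → proj₁ Fi′≐Gi yC , proj₁ Fj′≐Gj yD) (ind s C D C∩D≡∅ i′ j′)

    deterministic : DeterministicFam F → DeterministicFam G
    deterministic det s i =
      let (i′ , Fi′≐Gi) = proj₂ (F≋G ⊤ s) i in IsSingleton-resp-≐ Fi′≐Gi (det s i′)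

module _ {k : ℕ} {ST : Set} {L : ST → Pred AP 0ℓ} where

  module _ (M : ActionModel k ST L) where
    open ActionModel M

    outC-≐ : ∀ s C (σ : JA k AC C) → outC s C σ ≐ sc s ∩ ⋂[ C ] (λ a p → out a s (σ a p))
    outC-≐ s C σ = by-emptiness (nonempty? C)
      where
      by-emptiness : (d : Dec (Nonempty C)) →
                     outC' s C d σ ≐ sc s ∩ ⋂[ C ] (λ a p → out a s (σ a p))
      by-emptiness (no C≡∅) = (λ y∈sc → y∈sc , λ a p → ⊥-elim (C≡∅ (a , p))) , proj₁
      by-emptiness (yes (a , p)) = (λ h → proj₂ (cover a s) (σ a p , h a p) , h) , proj₂

    outC-joinJA : ∀ {s C D} {σC : JA k AC C} {σD : JA k AC D} → Disjoint C D →
                  outC s (C ∪ D) (joinJA k C D σC σD) ≐ outC s C σC ∩ outC s D σD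
    outC-joinJA {s} {C} {D} {σC} {σD} C∩D≡∅ =
      (λ h → let (y∈sc , hC∪D) = proj₁ (outC-≐ s (C ∪ D) _) h
                 (hC , hD)     = proj₁ (⋂-joinJA (λ a α → out a s α) C∩D≡∅) hC∪D
             in proj₂ (outC-≐ s C σC) (y∈sc , hC) , proj₂ (outC-≐ s D σD) (y∈sc , hD)) ,
      (λ (yC , yD) → let (y∈sc , hC) = proj₁ (outC-≐ s C σC) yC
                         (_    , hD) = proj₁ (outC-≐ s D σD) yD
                     in proj₂ (outC-≐ s (C ∪ D) _)
                          (y∈sc , proj₂ (⋂-joinJA (λ a α → out a s α) C∩D≡∅) (hC , hD)))

    IsXAction→IsXFam : ∀ X → IsXAction k X M → IsXFam X AE
    IsXAction→IsXFam X (ser , ind , det) =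
      ser , Req-map (hasI X) independent ind , Req-map (hasD X) deterministic det
      where
      independent : Independent → IndependentFam AE
      independent ind s C D C∩D≡∅ (σC , avC) (σD , avD) =
        map₂ (proj₁ (outC-joinJA C∩D≡∅)) (ind s C D C∩D≡∅ σC σD avC avD)

      deterministic : Deterministic → DeterministicFam AE
      deterministic det s (σ , av) = det s σ av

    IsXFam→IsXAction : ∀ X → IsXFam X AE → IsXAction k X M
    IsXFam→IsXAction X (ser , ind , det) =
      ser , Req-map (hasI X) independent ind , Req-map (hasD X) deterministic det
      where
      independent : IndependentFam AE → Independent
      independent ind s C D C∩D≡∅ σC σD avC avD =
        map₂ (proj₂ (outC-joinJA C∩D≡∅)) (ind s C D C∩D≡∅ (σC , avC) (σD , avD))

      deterministic : DeterministicFam AE → Deterministic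
      deterministic det s σ av = det s (σ , av)

  actionOutcomes : ActionModel k ST L → Fin k → ST → Family ST
  actionOutcomes M a s = fam (Σ AC λ α → Satisfiable (out a s α)) (λ i → out a s (proj₁ i))
    where open ActionModel M

  neighbourhoods : NbhdModel k ST L → Fin k → ST → Family ST
  neighbourhoods N a s = fam (NI a s) (nb a s)
    where open NbhdModel N

  ZRepresents-from-agents : (M : ActionModel k ST L) (N : NbhdModel k ST L) →
                            (∀ s → ActionModel.sc M s ≐ NbhdModel.sc N s) →
                            (∀ a s → actionOutcomes M a s ≋ neighbourhoods N a s) →
                            ZRepresents k N M
  ZRepresents-from-agents M N sc≐ agents≋ C s = to (nonempty? C) , from (nonempty? C)
    where
    module M = ActionModel M
    module N = NbhdModel N

    to : (d : Dec (Nonempty C)) (i : Σ (JA k M.AC C) λ σ → Satisfiable (M.outC' s C d σ)) →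
         Σ (Satisfiable (N.sc s) × N.neiI' s C d) λ j →
           M.outC' s C d (proj₁ i) ≐ N.neiM' s C d (proj₂ j)
    to (no _) (_ , y , y∈sc) = ((y , proj₁ (sc≐ s) y∈sc) , tt) , sc≐ s
    to (yes (a₀ , a₀∈C)) (σ , y , h) =
      ((y , proj₂ (N.cover a₀ s) (f a₀ a₀∈C , proj₁ out≐nb h a₀ a₀∈C)) , f , y , proj₁ out≐nb h) ,
      out≐nb
      where
      matched : ∀ a (p : a ∈ C) → Σ (N.NI a s) λ j → M.out a s (σ a p) ≐ N.nb a s j
      matched a p = proj₁ (agents≋ a s) (σ a p , y , h a p)

      f : ∀ a → a ∈ C → N.NI a s
      f a p = proj₁ (matched a p)

      out≐nb : ⋂[ C ] (λ a p → M.out a s (σ a p)) ≐ ⋂[ C ] (λ a p → N.nb a s (f a p))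
      out≐nb = ⋂-cong (λ a p → proj₂ (matched a p))

    from : (d : Dec (Nonempty C)) (j : Satisfiable (N.sc s) × N.neiI' s C d) →
           Σ (Σ (JA k M.AC C) λ σ → Satisfiable (M.outC' s C d σ)) λ i →
             M.outC' s C d (proj₁ i) ≐ N.neiM' s C d (proj₂ j)
    from (no _) ((y , y∈sc) , _) = ((λ _ _ → M.acNE) , y , proj₂ (sc≐ s) y∈sc) , sc≐ s
    from (yes _) (_ , f , y , h) = (σ , y , proj₂ out≐nb h) , out≐nb
      where
      matched : ∀ a (p : a ∈ C) →
                Σ (Idx (actionOutcomes M a s)) λ i → M.out a s (proj₁ i) ≐ N.nb a s (f a p)
      matched a p = proj₂ (agents≋ a s) (f a p)

      σ : JA k M.AC C
      σ a p = proj₁ (proj₁ (matched a p))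

      out≐nb : ⋂[ C ] (λ a p → M.out a s (σ a p)) ≐ ⋂[ C ] (λ a p → N.nb a s (f a p))
      out≐nb = ⋂-cong (λ a p → proj₂ (matched a p))

  module _ (M : ActionModel k ST L) where
    open ActionModel M

    toNbhd : NbhdModel k ST L
    toNbhd = record
      { sc    = sc
      ; NI    = λ a s → Idx (actionOutcomes M a s)
      ; nb    = λ a s → mem (actionOutcomes M a s)
      ; nbNE  = λ a s → proj₂
      ; cover = λ a s →
          (λ y∈sc → let (α , y∈out) = proj₁ (cover a s) y∈sc in (α , _ , y∈out) , y∈out) ,
          (λ ((α , _) , y∈out) → proj₂ (cover a s) (α , y∈out))
      }

    toNbhd-represents : ZRepresents k toNbhd M
    toNbhd-represents = ZRepresents-from-agents M toNbhd (λ _ → ≐-refl) (λ _ _ → ≋-refl)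

  module _ (N : NbhdModel k ST L) where
    open NbhdModel N

    -- nothing is a dummy action: AC must be inhabited even if every NI a s is empty.
    TaggedNbhd : Set
    TaggedNbhd = Maybe (Σ (Fin k) λ a → Σ ST λ s → NI a s)

    extent : TaggedNbhd → Sub ST
    extent nothing            = ∅
    extent (just (a , s , j)) = nb a s j

    -- Keeps out a s inside sc s: tags of other agents or states are not performable.
    performable : Fin k → ST → TaggedNbhd → Set
    performable a s α = Σ (NI a s) λ j → α ≡ just (a , s , j)

    toAction : ActionModel k ST L
    toAction = record
      { AC    = TaggedNbhd
      ; acNE  = nothing
      ; sc    = sc
      ; out   = λ a s α y → performable a s α × extent α y
      ; cover = λ a s →
          (λ y∈sc → let (j , y∈nb) = proj₁ (cover a s) y∈sc in just (a , s , j) , (j , refl) , y∈nb) ,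
          (λ { (_ , (j , refl) , y∈nb) → proj₂ (cover a s) (j , y∈nb) })
      }

    out-just : ∀ a s j → ActionModel.out toAction a s (just (a , s , j)) ≐ nb a s j
    out-just a s j = proj₂ , λ y∈nb → (j , refl) , y∈nb

    toAction-agents≋ : ∀ a s → actionOutcomes toAction a s ≋ neighbourhoods N a s
    toAction-agents≋ a s =
      (λ { (_ , _ , (j , refl) , _) → j , out-just a s j }) ,
      (λ j → (just (a , s , j) , map₂ (proj₂ (out-just a s j)) (nbNE a s j)) , out-just a s j)

    toAction-represented : ZRepresents k N toAction
    toAction-represented = ZRepresents-from-agents toAction N (λ _ → ≐-refl) toAction-agents≋

theorem4p14 : (n : ℕ) (X : ES) (ST : Set) → ST → (L : ST → Pred AP 0ℓ) →
    ((M : ActionModel (suc n) ST L) → IsXAction (suc n) X M →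
       Σ (NbhdModel (suc n) ST L) λ N → IsXNbhd (suc n) X N × ZRepresents (suc n) N M)
    × ((N : NbhdModel (suc n) ST L) → IsXNbhd (suc n) X N →
       Σ (ActionModel (suc n) ST L) λ M → IsXAction (suc n) X M × ZRepresents (suc n) N M)
theorem4p14 n X ST _ L =
  (λ M isX → toNbhd M ,
             IsXFam-resp-≋ X (toNbhd-represents M) (IsXAction→IsXFam M X isX) ,
             toNbhd-represents M) ,
  (λ N isX → toAction N ,
             IsXFam→IsXAction (toAction N) X
               (IsXFam-resp-≋ X (λ C s → ≋-sym (toAction-represented N C s)) isX) ,
             toAction-represented N)
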